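{- A weighted abstract simplicial complex $(\Sigma,\omega)$ is a Kleene complex if and only if there exist an integer $n\ge1$ and a subposet $(W,\preceq)$ of $(\{0,\tfrac12,1\}^n,\preceq_n)$ such that $(\Sigma,\omega)$ is isomorphic to the weighted abstract simplicial complex $(\mathcal N(W),\mathrm{den})$.
   Context: An abstract simplicial complex over a finite set $V$ is a family of subsets of $V$ closed under taking subsets and containing all singletons; a weighted one is a pair $(\Sigma,\omega)$ with $\omega\colon V\to\{1,2,\dots\}$. An isomorphism of weighted abstract simplicial complexes $(\Sigma,\omega)$, $(\Sigma',\omega')$ over $V,V'$ is a bijection $f\colon V\to V'$ such that $S\in\Sigma$ iff $f(S)\in\Sigma'$, and $\omega'\circ f=\omega$. A missing face of $\Sigma$ is a set $N\subseteq V$ with $N\notin\Sigma$ but every proper subset of $N$ in $\Sigma$. $\Sigma^{(2)}$ is the graph whose edges are the $2$-element members of $\Sigma$; a comparability over it is an orientation of its edges that is transitive (oriented edges $(p,r_1),(r_1,r_2),\dots,(r_u,q)$ imply $\{p,q\}$ is an edge oriented $(p,q)$); a sink is a vertex that is not the first element of any oriented edge. $(\Sigma,\omega)$ is a Kleene complex if (a) $\omega(v)\in\{1,2\}$ for all $v\in V$; (b) $\Sigma$ has no missing face of cardinality $\ge3$; (c) there is a comparability over $\Sigma^{(2)}$ in which every $v$ with $\omega(v)=1$ is a sink. On $\{0,\tfrac12,1\}$, $\preceq$ is the order with $\tfrac12\preceq0$, $\tfrac12\preceq1$, $0,1$ incomparable; $\preceq_n$ is the componentwise order on $\{0,\tfrac12,1\}^n$.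 $\mathcal N(W)$ is the nerve of $W$: the set of all chains of $(W,\preceq)$, an abstract simplicial complex over $W$. For $v=(p_1/q_1,\dots,p_n/q_n)\in\mathbb Q^n$ in lowest terms with $q_i>0$, $\mathrm{den}(v)=\mathrm{lcm}(q_1,\dots,q_n)$; on $\{0,\tfrac12,1\}^n$, $\mathrm{den}(v)=1$ if $v\in\{0,1\}^n$ and $2$ otherwise. -}

module Defs where

open import Data.Bool using (Bool; true; false)
open import Data.Nat using (ℕ; zero; suc; _≤_)
open import Data.Fin using (Fin)
open import Data.Fin.Subset using (Subset; _∈_; _∉_; _⊆_; _⊂_; ⁅_⁆; _∪_; ∣_∣) renaming (⊥ to ∅)
open import Data.Vec using (Vec; []; _∷_)
open import Data.List using (List; []; _∷_)
open import Data.Product using (Σ; _×_; ∃; ∃-syntax; proj₁)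
open import Data.Sum using (_⊎_)
open import Relation.Nullary using (¬_)
open import Relation.Binary.PropositionalEquality using (_≡_; _≢_)
open import Function.Bundles using (_⤖_; Bijection)

Family : ℕ → Set
Family k = Subset k → Bool

_∈F_ : ∀ {k} → Subset k → Family k → Set
S ∈F Δ = Δ S ≡ true

record IsASC {k : ℕ} (Δ : Family k) : Set where
  field
    empty-face : ∅ ∈F Δ
    down-closed : ∀ (S T : Subset k) → S ⊆ T → T ∈F Δ → S ∈F Δ
    singletons : ∀ (v : Fin k) → ⁅ v ⁆ ∈F Δ

record IsWASC {k : ℕ} (Δ : Family k) (ω : Fin k → ℕ) : Set where
  field
    asc : IsASC Δ
    positive : ∀ (v : Fin k) → 1 ≤ ω v

IsMissingFace : ∀ {k} → Family k → Subset k → Set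
IsMissingFace {k} Δ N = ¬ (N ∈F Δ) × (∀ (S : Subset k) → S ⊂ N → S ∈F Δ)

IsEdge : ∀ {k} → Family k → Fin k → Fin k → Set
IsEdge Δ p q = p ≢ q × ((⁅ p ⁆ ∪ ⁅ q ⁆) ∈F Δ)

OPath : ∀ {k} → (Fin k → Fin k → Bool) → Fin k → List (Fin k) → Fin k → Set
OPath O p [] q = O p q ≡ true
OPath O p (r ∷ rs) q = (O p r ≡ true) × OPath O r rs q

-- A comparability over Σ^(2): an orientation O of the edges of Σ^(2)
-- (O p q ≡ true means the edge {p,q} is oriented (p,q)) that is transitive.
record IsComparability {k : ℕ} (Δ : Family k) (O : Fin k → Fin k → Bool) : Set where
  field
    only-edges : ∀ (p q : Fin k) → O p q ≡ true → IsEdge Δ p q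
    oriented : ∀ (p q : Fin k) → IsEdge Δ p q → (O p q ≡ true) ⊎ (O q p ≡ true)
    one-way : ∀ (p q : Fin k) → O p q ≡ true → ¬ (O q p ≡ true)
    transitive : ∀ (p q r : Fin k) (rs : List (Fin k)) →
                 OPath O p (r ∷ rs) q → O p q ≡ true

IsSink : ∀ {k} → (Fin k → Fin k → Bool) → Fin k → Set
IsSink {k} O v = ∀ (q : Fin k) → ¬ (O v q ≡ true)

record IsKleene {k : ℕ} (Δ : Family k) (ω : Fin k → ℕ) : Set where
  field
    weights : ∀ (v : Fin k) → (ω v ≡ 1) ⊎ (ω v ≡ 2)
    no-big-missing : ∀ (N : Subset k) → 3 ≤ ∣ N ∣ → ¬ IsMissingFace Δ N
    comparability : ∃[ O ] (IsComparability Δ O ×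
                      (∀ (v : Fin k) → ω v ≡ 1 → IsSink O v))

data Three : Set where
  t0 t½ t1 : Three

data _⪯_ : Three → Three → Set where
  ⪯-refl : ∀ {a} → a ⪯ a
  ½⪯0 : t½ ⪯ t0
  ½⪯1 : t½ ⪯ t1

data _⪯ₙ_ : ∀ {n} → Vec Three n → Vec Three n → Set where
  []  : [] ⪯ₙ []
  _∷_ : ∀ {n a b} {xs ys : Vec Three n} → a ⪯ b → xs ⪯ₙ ys → (a ∷ xs) ⪯ₙ (b ∷ ys)

den : ∀ {n} → Vec Three n → ℕ
den [] = 1
den (t0 ∷ xs) = den xs
den (t1 ∷ xs) = den xs
den (t½ ∷ xs) = 2

SubsetOf3ⁿ : ℕ → Set
SubsetOf3ⁿ n = Vec Three n → Bool

Elem : ∀ {n} → SubsetOf3ⁿ n → Set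
Elem {n} W = Σ (Vec Three n) (λ x → W x ≡ true)

_⪯W_ : ∀ {n} {W : SubsetOf3ⁿ n} → Elem W → Elem W → Set
x ⪯W y = proj₁ x ⪯ₙ proj₁ y

IsChain : ∀ {A : Set} → (A → A → Set) → (A → Set) → Set
IsChain {A} _≤_ C = ∀ (x y : A) → C x → C y → (x ≤ y) ⊎ (y ≤ x)

InNerve : ∀ {n} (W : SubsetOf3ⁿ n) → (Elem W → Set) → Set
InNerve W C = IsChain (_⪯W_ {W = W}) C

Image : ∀ {k} {B : Set} → (Fin k → B) → Subset k → B → Set
Image {k} f S b = ∃[ i ] (i ∈ S × f i ≡ b)

record IsoToNerve {k : ℕ} (Δ : Family k) (ω : Fin k → ℕ) {n : ℕ} (W : SubsetOf3ⁿ n) : Set where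
  field
    bij : Fin k ⤖ Elem W
  f : Fin k → Elem W
  f = Bijection.to bij
  field
    faces : ∀ (S : Subset k) → (S ∈F Δ → InNerve W (Image f S)) × (InNerve W (Image f S) → S ∈F Δ)
    weight : ∀ (v : Fin k) → den (proj₁ (f v)) ≡ ω v

module Submission where

-- A nerve is a flag complex (a set is a chain iff its pairs are), so it has no missing face
-- of size ≥ 3; the strict order of W orients its edges transitively, and a vertex with den 1
-- lies in {0,1}ⁿ, whose points are maximal, so it is a sink.  Conversely, the reflexive
-- closure ⊑ of the comparability of a Kleene complex is a partial order whose chains are
-- exactly the faces (by the flag property), and ⊑ order-embeds into {0,½,1}^(1+k) with one
-- coordinate per vertex plus one recording the weight.

open import Defs
open import Data.Nat using (ℕ; _≤_)
open import Data.Fin using (Fin)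
open import Data.Product using (_×_; ∃-syntax)

open import Axiom.UniquenessOfIdentityProofs using (module Decidable⇒UIP)
open import Data.Bool using (Bool; true)
import Data.Bool as Bool
open import Data.Bool.Properties using (T-≡)
open import Data.Empty using (⊥-elim)
open import Data.Fin using (zero; suc)
open import Data.Fin.Properties using (any?) renaming (_≟_ to _≟ᶠ_)
open import Data.Fin.Subset using (Subset; _∈_; _∉_; _⊆_; _⊂_; ⁅_⁆; _∪_; ∣_∣; inside; outside)
  renaming (⊥ to ∅)
open import Data.Fin.Subset.Induction using (⊂-wellFounded; Acc; acc)
open import Data.Fin.Subset.Properties
  using (_∈?_; x∈⁅x⁆; x∈⁅y⁆⇒x≡y; x∈p∪q⁻; x∈p∪q⁺; p⊆p∪q; ∣⁅x⁆∣≡1; p⊆q⇒∣p∣≤∣q∣; p⊂q⇒∣p∣<∣q∣; ∪-comm; ∪-idem)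
open import Data.List using ([]; _∷_)
open import Data.Nat using (zero; suc; _+_; _<_; z≤n; s≤s)
import Data.Nat.Properties as ℕ
open import Data.Product using (∃; _,_; proj₁; proj₂; uncurry)
open import Data.Sum using (_⊎_; inj₁; inj₂; [_,_]; swap) renaming (map to ⊎-map)
open import Data.Vec using (Vec; []; _∷_; tabulate)
open import Data.Vec.Properties using (≡-dec)
open import Function.Base using (_on_; _∘_)
open import Function.Bundles using (_⇔_; mk⇔; Equivalence; Bijection; mk⤖)
open import Relation.Binary.PropositionalEquality using (_≡_; _≢_; refl; sym; trans; cong; cong₂; subst)
open import Relation.Binary.Definitions using (DecidableEquality)
open import Relation.Nullary using (¬_; Dec; yes; no; ¬?)
import Relation.Nullary.Decidable as Dec
open import Relation.Nullary.Decidable using (_×-dec_; _⊎-dec_; isYes; toWitness; fromWitness; decidable-stable)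

isYes⇒witness : ∀ {P : Set} (P? : Dec P) → isYes P? ≡ true → P
isYes⇒witness P? = toWitness {a? = P?} ∘ Equivalence.from T-≡

witness⇒isYes : ∀ {P : Set} (P? : Dec P) → P → isYes P? ≡ true
witness⇒isYes P? = Equivalence.to T-≡ ∘ fromWitness {a? = P?}

Elem-≡ : ∀ {n} {W : SubsetOf3ⁿ n} {a b : Elem W} → proj₁ a ≡ proj₁ b → a ≡ b
Elem-≡ {a = x , p} {b = .x , q} refl = cong (x ,_) (Decidable⇒UIP.≡-irrelevant Bool._≟_ p q)

-- The poset {0, ½, 1} and its powers

½⪯ : ∀ a → t½ ⪯ a
½⪯ t0 = ½⪯0
½⪯ t½ = ⪯-refl
½⪯ t1 = ½⪯1

⪯-trans : ∀ {a b c} → a ⪯ b → b ⪯ c → a ⪯ c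
⪯-trans ⪯-refl b⪯c = b⪯c
⪯-trans ½⪯0 ⪯-refl = ½⪯0
⪯-trans ½⪯1 ⪯-refl = ½⪯1

⪯-antisym : ∀ {a b} → a ⪯ b → b ⪯ a → a ≡ b
⪯-antisym ⪯-refl _ = refl

_⪯?_ : ∀ a b → Dec (a ⪯ b)
t½ ⪯? b = yes (½⪯ b)
t0 ⪯? t0 = yes ⪯-refl
t0 ⪯? t½ = no λ ()
t0 ⪯? t1 = no λ ()
t1 ⪯? t0 = no λ ()
t1 ⪯? t½ = no λ ()
t1 ⪯? t1 = yes ⪯-refl

_≟₃_ : DecidableEquality Three
a ≟₃ b = Dec.map′ (uncurry ⪯-antisym) (λ { refl → ⪯-refl , ⪯-refl }) ((a ⪯? b) ×-dec (b ⪯? a))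

⪯ₙ-refl : ∀ {n} {xs : Vec Three n} → xs ⪯ₙ xs
⪯ₙ-refl {xs = []} = []
⪯ₙ-refl {xs = _ ∷ _} = ⪯-refl ∷ ⪯ₙ-refl

⪯ₙ-trans : ∀ {n} {xs ys zs : Vec Three n} → xs ⪯ₙ ys → ys ⪯ₙ zs → xs ⪯ₙ zs
⪯ₙ-trans [] [] = []
⪯ₙ-trans (a ∷ p) (b ∷ q) = ⪯-trans a b ∷ ⪯ₙ-trans p q

⪯ₙ-antisym : ∀ {n} {xs ys : Vec Three n} → xs ⪯ₙ ys → ys ⪯ₙ xs → xs ≡ ys
⪯ₙ-antisym [] [] = refl
⪯ₙ-antisym (a ∷ p) (b ∷ q) = cong₂ _∷_ (⪯-antisym a b) (⪯ₙ-antisym p q)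

_⪯ₙ?_ : ∀ {n} (xs ys : Vec Three n) → Dec (xs ⪯ₙ ys)
[] ⪯ₙ? [] = yes []
(x ∷ xs) ⪯ₙ? (y ∷ ys) with x ⪯? y | xs ⪯ₙ? ys
... | yes a | yes p = yes (a ∷ p)
... | no ¬a | _ = no λ { (a ∷ _) → ¬a a }
... | yes _ | no ¬p = no λ { (_ ∷ p) → ¬p p }

tabulate-⪯ₙ⁺ : ∀ {n} {a b : Fin n → Three} → (∀ i → a i ⪯ b i) → tabulate a ⪯ₙ tabulate b
tabulate-⪯ₙ⁺ {zero} _ = []
tabulate-⪯ₙ⁺ {suc n} a⪯b = a⪯b zero ∷ tabulate-⪯ₙ⁺ (a⪯b ∘ suc)

tabulate-⪯ₙ⁻ : ∀ {n} {a b : Fin n → Three} → tabulate a ⪯ₙ tabulate b → ∀ i → a i ⪯ b i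
tabulate-⪯ₙ⁻ (p ∷ _) zero = p
tabulate-⪯ₙ⁻ (_ ∷ ps) (suc i) = tabulate-⪯ₙ⁻ ps i

den≡1⊎den≡2 : ∀ {n} (xs : Vec Three n) → den xs ≡ 1 ⊎ den xs ≡ 2
den≡1⊎den≡2 [] = inj₁ refl
den≡1⊎den≡2 (t0 ∷ xs) = den≡1⊎den≡2 xs
den≡1⊎den≡2 (t½ ∷ xs) = inj₂ refl
den≡1⊎den≡2 (t1 ∷ xs) = den≡1⊎den≡2 xs

den≡1⇒maximal : ∀ {n} {xs ys : Vec Three n} → den xs ≡ 1 → xs ⪯ₙ ys → xs ≡ ys
den≡1⇒maximal {xs = []} _ [] = refl
den≡1⇒maximal {xs = t0 ∷ _} d (⪯-refl ∷ p) = cong (t0 ∷_) (den≡1⇒maximal d p)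
den≡1⇒maximal {xs = t1 ∷ _} d (⪯-refl ∷ p) = cong (t1 ∷_) (den≡1⇒maximal d p)

den-tabulate≡1 : ∀ {n} (a : Fin n → Three) → (∀ i → a i ≡ t0 ⊎ a i ≡ t1) → den (tabulate a) ≡ 1
den-tabulate≡1 {zero} _ _ = refl
den-tabulate≡1 {suc n} a a∈01 with a zero | a∈01 zero
... | .t0 | inj₁ refl = den-tabulate≡1 (a ∘ suc) (a∈01 ∘ suc)
... | .t1 | inj₂ refl = den-tabulate≡1 (a ∘ suc) (a∈01 ∘ suc)

∣p∪q∣≤∣p∣+∣q∣ : ∀ {n} (p q : Subset n) → ∣ p ∪ q ∣ ≤ ∣ p ∣ + ∣ q ∣
∣p∪q∣≤∣p∣+∣q∣ [] [] = z≤n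
∣p∪q∣≤∣p∣+∣q∣ (outside ∷ p) (outside ∷ q) = ∣p∪q∣≤∣p∣+∣q∣ p q
∣p∪q∣≤∣p∣+∣q∣ (outside ∷ p) (inside ∷ q) =
  subst (suc ∣ p ∪ q ∣ ≤_) (sym (ℕ.+-suc ∣ p ∣ ∣ q ∣)) (s≤s (∣p∪q∣≤∣p∣+∣q∣ p q))
∣p∪q∣≤∣p∣+∣q∣ (inside ∷ p) (outside ∷ q) = s≤s (∣p∪q∣≤∣p∣+∣q∣ p q)
∣p∪q∣≤∣p∣+∣q∣ (inside ∷ p) (inside ∷ q) =
  s≤s (ℕ.≤-trans (∣p∪q∣≤∣p∣+∣q∣ p q) (ℕ.+-monoʳ-≤ ∣ p ∣ (ℕ.n≤1+n ∣ q ∣)))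

∣⁅x⁆∪⁅y⁆∣≤2 : ∀ {n} (x y : Fin n) → ∣ ⁅ x ⁆ ∪ ⁅ y ⁆ ∣ ≤ 2
∣⁅x⁆∪⁅y⁆∣≤2 x y = subst (∣ ⁅ x ⁆ ∪ ⁅ y ⁆ ∣ ≤_) (cong₂ _+_ (∣⁅x⁆∣≡1 x) (∣⁅x⁆∣≡1 y)) (∣p∪q∣≤∣p∣+∣q∣ ⁅ x ⁆ ⁅ y ⁆)

x∈⁅x⁆∪⁅y⁆ : ∀ {n} (x y : Fin n) → x ∈ ⁅ x ⁆ ∪ ⁅ y ⁆
x∈⁅x⁆∪⁅y⁆ x y = x∈p∪q⁺ (inj₁ (x∈⁅x⁆ x))

y∈⁅x⁆∪⁅y⁆ : ∀ {n} (x y : Fin n) → y ∈ ⁅ x ⁆ ∪ ⁅ y ⁆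
y∈⁅x⁆∪⁅y⁆ x y = x∈p∪q⁺ (inj₂ (x∈⁅x⁆ y))

x∈⁅y⁆∪⁅z⁆⇒x≡y⊎x≡z : ∀ {n} {x y z : Fin n} → x ∈ ⁅ y ⁆ ∪ ⁅ z ⁆ → x ≡ y ⊎ x ≡ z
x∈⁅y⁆∪⁅z⁆⇒x≡y⊎x≡z {y = y} {z} = ⊎-map (x∈⁅y⁆⇒x≡y y) (x∈⁅y⁆⇒x≡y z) ∘ x∈p∪q⁻ ⁅ y ⁆ ⁅ z ⁆

⁅x⁆∪⁅y⁆⊆p : ∀ {n} {x y : Fin n} {p : Subset n} → x ∈ p → y ∈ p → ⁅ x ⁆ ∪ ⁅ y ⁆ ⊆ p
⁅x⁆∪⁅y⁆⊆p x∈p y∈p z∈ = [ (λ { refl → x∈p }) , (λ { refl → y∈p }) ] (x∈⁅y⁆∪⁅z⁆⇒x≡y⊎x≡z z∈)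

⊆⊎∃∉ : ∀ {n} (p q : Subset n) → p ⊆ q ⊎ ∃ λ x → x ∈ p × x ∉ q
⊆⊎∃∉ p q with any? (λ x → x ∈? p ×-dec ¬? (x ∈? q))
... | yes w = inj₂ w
... | no none = inj₁ λ {x} x∈p → decidable-stable (x ∈? q) (λ x∉q → none (x , x∈p , x∉q))

3≤∣p∣⇒⁅x⁆∪⁅y⁆⊂p : ∀ {n} {x y : Fin n} {p : Subset n} →
                   3 ≤ ∣ p ∣ → x ∈ p → y ∈ p → ⁅ x ⁆ ∪ ⁅ y ⁆ ⊂ p
3≤∣p∣⇒⁅x⁆∪⁅y⁆⊂p {x = x} {y} {p} 3≤∣p∣ x∈p y∈p with ⊆⊎∃∉ p (⁅ x ⁆ ∪ ⁅ y ⁆)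
... | inj₂ (z , z∈p , z∉) = ⁅x⁆∪⁅y⁆⊆p x∈p y∈p , z , z∈p , z∉
... | inj₁ p⊆ = ⊥-elim (ℕ.<⇒≱ 3≤∣p∣ (ℕ.≤-trans (p⊆q⇒∣p∣≤∣q∣ p⊆) (∣⁅x⁆∪⁅y⁆∣≤2 x y)))

⁅x⁆⊂p⊂q⇒3≤∣q∣ : ∀ {n} {x : Fin n} {p q : Subset n} → ⁅ x ⁆ ⊂ p → p ⊂ q → 3 ≤ ∣ q ∣
⁅x⁆⊂p⊂q⇒3≤∣q∣ {x = x} x⊂p p⊂q =
  ℕ.≤-trans (s≤s (subst (_< _) (∣⁅x⁆∣≡1 x) (p⊂q⇒∣p∣<∣q∣ x⊂p))) (p⊂q⇒∣p∣<∣q∣ p⊂q)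

PairwiseComparable : ∀ {k} → (Fin k → Fin k → Set) → Subset k → Set
PairwiseComparable R S = ∀ {i j} → i ∈ S → j ∈ S → R i j ⊎ R j i

PairwiseComparable-map : ∀ {k} {R R′ : Fin k → Fin k → Set} {S} →
                         (∀ {i j} → R i j → R′ i j) → PairwiseComparable R S → PairwiseComparable R′ S
PairwiseComparable-map R⇒R′ pc i∈ j∈ = ⊎-map R⇒R′ R⇒R′ (pc i∈ j∈)

PairwiseComparable-pair : ∀ {k} {R : Fin k → Fin k → Set} {x y} →
                          (∀ {i} → R i i) → R x y ⊎ R y x → PairwiseComparable R (⁅ x ⁆ ∪ ⁅ y ⁆)
PairwiseComparable-pair R-refl xy i∈ j∈
  with x∈⁅y⁆∪⁅z⁆⇒x≡y⊎x≡z i∈ | x∈⁅y⁆∪⁅z⁆⇒x≡y⊎x≡z j∈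
... | inj₁ refl | inj₁ refl = inj₁ R-refl
... | inj₂ refl | inj₂ refl = inj₁ R-refl
... | inj₁ refl | inj₂ refl = xy
... | inj₂ refl | inj₁ refl = swap xy

IsChain-Image⁺ : ∀ {k} {B : Set} {R : B → B → Set} {f : Fin k → B} {S} →
                 PairwiseComparable (R on f) S → IsChain R (Image f S)
IsChain-Image⁺ pc _ _ (_ , i∈ , refl) (_ , j∈ , refl) = pc i∈ j∈

IsChain-Image⁻ : ∀ {k} {B : Set} {R : B → B → Set} {f : Fin k → B} {S} →
                 IsChain R (Image f S) → PairwiseComparable (R on f) S
IsChain-Image⁻ ch i∈ j∈ = ch _ _ (_ , i∈ , refl) (_ , j∈ , refl)

-- As |N| ≥ 3, any two elements of N lie in a proper subset of N, which is a face.
pairwise⇒no-big-missing-face : ∀ {k} {Δ : Family k} {R : Fin k → Fin k → Set} →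
                               (∀ S → S ∈F Δ ⇔ PairwiseComparable R S) →
                               ∀ N → 3 ≤ ∣ N ∣ → ¬ IsMissingFace Δ N
pairwise⇒no-big-missing-face {Δ = Δ} {R} faces N 3≤∣N∣ (N∉Δ , proper) =
  N∉Δ (Equivalence.from (faces N) pairwise)
  where
  pairwise : PairwiseComparable R N
  pairwise {i} {j} i∈ j∈ =
    Equivalence.to (faces _) (proper _ (3≤∣p∣⇒⁅x⁆∪⁅y⁆⊂p 3≤∣N∣ i∈ j∈)) (x∈⁅x⁆∪⁅y⁆ i j) (y∈⁅x⁆∪⁅y⁆ i j)

PairsIn : ∀ {k} → Family k → Subset k → Set
PairsIn Δ S = ∀ {p q} → p ∈ S → q ∈ S → (⁅ p ⁆ ∪ ⁅ q ⁆) ∈F Δ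

no-big-missing-face⇒flag : ∀ {k} {Δ : Family k} → IsASC Δ →
                           (∀ N → 3 ≤ ∣ N ∣ → ¬ IsMissingFace Δ N) →
                           ∀ S → PairsIn Δ S → S ∈F Δ
no-big-missing-face⇒flag {Δ = Δ} asc no-big-missing S = go S (⊂-wellFounded S)
  where
  open IsASC asc
  go : ∀ S → Acc _⊂_ S → PairsIn Δ S → S ∈F Δ
  go S (acc smaller) pairs with ⊆⊎∃∉ S ∅
  ... | inj₁ S⊆∅ = down-closed S ∅ S⊆∅ empty-face
  ... | inj₂ (p , p∈ , _) with ⊆⊎∃∉ S ⁅ p ⁆
  ...   | inj₁ S⊆p = down-closed S ⁅ p ⁆ S⊆p (singletons p)
  ...   | inj₂ (q , q∈ , q∉) with ⊆⊎∃∉ S (⁅ p ⁆ ∪ ⁅ q ⁆)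
  ...     | inj₁ S⊆pq = down-closed S _ S⊆pq (pairs p∈ q∈)
  -- Now |S| ≥ 3 and, by induction, every proper subset of S is a face: S is not missing.
  ...     | inj₂ (r , r∈ , r∉) = decidable-stable (Δ S Bool.≟ true) λ S∉Δ →
    no-big-missing S (⁅x⁆⊂p⊂q⇒3≤∣q∣ p⊂pq pq⊂S) (S∉Δ , λ T T⊂S →
      go T (smaller T⊂S) λ a∈ b∈ → pairs (proj₁ T⊂S a∈) (proj₁ T⊂S b∈))
    where
    p⊂pq : ⁅ p ⁆ ⊂ ⁅ p ⁆ ∪ ⁅ q ⁆
    p⊂pq = p⊆p∪q _ , q , y∈⁅x⁆∪⁅y⁆ p q , q∉
    pq⊂S : ⁅ p ⁆ ∪ ⁅ q ⁆ ⊂ S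
    pq⊂S = ⁅x⁆∪⁅y⁆⊆p p∈ q∈ , r , r∈ , r∉

-- A nerve is a Kleene complex

module FromNerve {k} {Δ : Family k} {ω : Fin k → ℕ} {n} {W : SubsetOf3ⁿ n}
                 (iso : IsoToNerve Δ ω W) where
  open IsoToNerve iso

  _≼_ : Fin k → Fin k → Set
  _≼_ = _⪯ₙ_ on (proj₁ ∘ f)

  faces⇔pairwise : ∀ S → S ∈F Δ ⇔ PairwiseComparable _≼_ S
  faces⇔pairwise S = mk⇔ (IsChain-Image⁻ ∘ proj₁ (faces S)) (proj₂ (faces S) ∘ IsChain-Image⁺)

  pair-face⇔comparable : ∀ {p q} → (⁅ p ⁆ ∪ ⁅ q ⁆) ∈F Δ ⇔ (p ≼ q ⊎ q ≼ p)
  pair-face⇔comparable {p} {q} = mk⇔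
    (λ pq∈Δ → Equivalence.to (faces⇔pairwise _) pq∈Δ (x∈⁅x⁆∪⁅y⁆ p q) (y∈⁅x⁆∪⁅y⁆ p q))
    (Equivalence.from (faces⇔pairwise _) ∘ PairwiseComparable-pair ⪯ₙ-refl)

  ≼-antisym : ∀ {p q} → p ≼ q → q ≼ p → p ≡ q
  ≼-antisym p≼q q≼p = Bijection.injective bij (Elem-≡ (⪯ₙ-antisym p≼q q≼p))

  _≺_ : Fin k → Fin k → Set
  p ≺ q = p ≼ q × p ≢ q

  ≺-trans : ∀ {p q r} → p ≺ q → q ≺ r → p ≺ r
  ≺-trans (p≼q , p≢q) (q≼r , _) = ⪯ₙ-trans p≼q q≼r , λ { refl → p≢q (≼-antisym p≼q q≼r) }

  _≺?_ : ∀ p q → Dec (p ≺ q)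
  p ≺? q = (proj₁ (f p) ⪯ₙ? proj₁ (f q)) ×-dec ¬? (p ≟ᶠ q)

  orientation : Fin k → Fin k → Bool
  orientation p q = isYes (p ≺? q)

  oriented⇒≺ : ∀ {p q} → orientation p q ≡ true → p ≺ q
  oriented⇒≺ {p} {q} = isYes⇒witness (p ≺? q)

  ≺⇒oriented : ∀ {p q} → p ≺ q → orientation p q ≡ true
  ≺⇒oriented {p} {q} = witness⇒isYes (p ≺? q)

  OPath⇒≺ : ∀ {p q} rs → OPath orientation p rs q → p ≺ q
  OPath⇒≺ [] pq = oriented⇒≺ pq
  OPath⇒≺ (_ ∷ rs) (pr , path) = ≺-trans (oriented⇒≺ pr) (OPath⇒≺ rs path)

  isComparability : IsComparability Δ orientation
  isComparability = record
    { only-edges = λ _ _ pq → let (p≼q , p≢q) = oriented⇒≺ pq in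
                              p≢q , Equivalence.from pair-face⇔comparable (inj₁ p≼q)
    ; oriented = λ _ _ (p≢q , pq∈Δ) →
        ⊎-map (λ p≼q → ≺⇒oriented (p≼q , p≢q)) (λ q≼p → ≺⇒oriented (q≼p , p≢q ∘ sym))
              (Equivalence.to pair-face⇔comparable pq∈Δ)
    ; one-way = λ _ _ pq qp →
        proj₂ (oriented⇒≺ pq) (≼-antisym (proj₁ (oriented⇒≺ pq)) (proj₁ (oriented⇒≺ qp)))
    ; transitive = λ _ _ r rs → ≺⇒oriented ∘ OPath⇒≺ (r ∷ rs)
    }

  weight-1⇒sink : ∀ v → ω v ≡ 1 → IsSink orientation v
  weight-1⇒sink v ωv≡1 q vq =
    let (v≼q , v≢q) = oriented⇒≺ vq
    in v≢q (Bijection.injective bij (Elem-≡ (den≡1⇒maximal (trans (weight v) ωv≡1) v≼q)))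

  isKleene : IsKleene Δ ω
  isKleene = record
    { weights = λ v → subst (λ w → w ≡ 1 ⊎ w ≡ 2) (weight v) (den≡1⊎den≡2 (proj₁ (f v)))
    ; no-big-missing = pairwise⇒no-big-missing-face faces⇔pairwise
    ; comparability = orientation , isComparability , weight-1⇒sink
    }

-- A Kleene complex is a nerve

threeValued : ∀ {A B : Set} → Dec A → Dec B → Three
threeValued (yes _) _ = t1
threeValued (no _) (yes _) = t½
threeValued (no _) (no _) = t0

module ToNerve {k} {Δ : Family k} {ω : Fin k → ℕ} (asc : IsASC Δ) (kleene : IsKleene Δ ω) where
  open IsASC asc
  open IsKleene kleene

  orientation : Fin k → Fin k → Bool
  orientation = proj₁ comparability

  open IsComparability (proj₁ (proj₂ comparability))

  weight-1⇒sink : ∀ v → ω v ≡ 1 → IsSink orientation v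
  weight-1⇒sink = proj₂ (proj₂ comparability)

  _⊑_ : Fin k → Fin k → Set
  x ⊑ y = x ≡ y ⊎ orientation x y ≡ true

  _⊑?_ : ∀ x y → Dec (x ⊑ y)
  x ⊑? y = (x ≟ᶠ y) ⊎-dec (orientation x y Bool.≟ true)

  ⊑-trans : ∀ {x y z} → x ⊑ y → y ⊑ z → x ⊑ z
  ⊑-trans (inj₁ refl) y⊑z = y⊑z
  ⊑-trans (inj₂ xy) (inj₁ refl) = inj₂ xy
  ⊑-trans (inj₂ xy) (inj₂ yz) = inj₂ (transitive _ _ _ [] (xy , yz))

  ⊑-antisym : ∀ {x y} → x ⊑ y → y ⊑ x → x ≡ y
  ⊑-antisym (inj₁ x≡y) _ = x≡y
  ⊑-antisym (inj₂ _) (inj₁ y≡x) = sym y≡x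
  ⊑-antisym (inj₂ xy) (inj₂ yx) = ⊥-elim (one-way _ _ xy yx)

  HaveUpperBound : Fin k → Fin k → Set
  HaveUpperBound x v = ∃ λ y → x ⊑ y × v ⊑ y

  haveUpperBound? : ∀ x v → Dec (HaveUpperBound x v)
  haveUpperBound? x v = any? λ y → (x ⊑? y) ×-dec (v ⊑? y)

  -- Coordinate v of the image of x is 1 if v ⊑ x, ½ if x and v merely have a common upper
  -- bound, 0 otherwise.  A weight-1 vertex is a sink, so its coordinates avoid ½; the extra
  -- weight coordinate is ½ exactly on weight-2 vertices, which makes den agree with ω.
  coordinate : Fin k → Fin k → Three
  coordinate x v = threeValued (v ⊑? x) (haveUpperBound? x v)

  weightCoordinate : Fin k → Three
  weightCoordinate x with ω x ℕ.≟ 1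
  ... | yes _ = t0
  ... | no _ = t½

  embed : Fin k → Vec Three (suc k)
  embed x = weightCoordinate x ∷ tabulate (coordinate x)

  coordinate-mono : ∀ {x y} v → x ⊑ y → coordinate x v ⪯ coordinate y v
  coordinate-mono {x} {y} v x⊑y with v ⊑? x | haveUpperBound? x v | v ⊑? y | haveUpperBound? y v
  ... | yes _ | _ | yes _ | _ = ⪯-refl
  ... | yes v⊑x | _ | no v⋢y | _ = ⊥-elim (v⋢y (⊑-trans v⊑x x⊑y))
  ... | no _ | yes _ | _ | _ = ½⪯ _
  ... | no _ | no ∄ub | yes v⊑y | _ = ⊥-elim (∄ub (y , x⊑y , v⊑y))
  ... | no _ | no ∄ub | no _ | yes (z , y⊑z , v⊑z) = ⊥-elim (∄ub (z , ⊑-trans x⊑y y⊑z , v⊑z))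
  ... | no _ | no _ | no _ | no _ = ⪯-refl

  coordinate-self : ∀ x → coordinate x x ≡ t1
  coordinate-self x with x ⊑? x
  ... | yes _ = refl
  ... | no x⋢x = ⊥-elim (x⋢x (inj₁ refl))

  t1⪯coordinate⇒⊑ : ∀ {x y} → t1 ⪯ coordinate y x → x ⊑ y
  t1⪯coordinate⇒⊑ {x} {y} t1⪯ with x ⊑? y | haveUpperBound? y x | t1⪯
  ... | yes x⊑y | _ | _ = x⊑y
  ... | no _ | yes _ | ()
  ... | no _ | no _ | ()

  sink⇒coordinate∈01 : ∀ {x} → IsSink orientation x → ∀ v → coordinate x v ≡ t0 ⊎ coordinate x v ≡ t1
  sink⇒coordinate∈01 {x} sink v with v ⊑? x | haveUpperBound? x v
  ... | yes _ | _ = inj₂ refl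
  ... | no _ | no _ = inj₁ refl
  ... | no v⋢x | yes (_ , inj₁ refl , v⊑x) = ⊥-elim (v⋢x v⊑x)
  ... | no _ | yes (y , inj₂ xy , _) = ⊥-elim (sink y xy)

  weightCoordinate-mono : ∀ {x y} → x ⊑ y → weightCoordinate x ⪯ weightCoordinate y
  weightCoordinate-mono (inj₁ refl) = ⪯-refl
  weightCoordinate-mono {x} {y} (inj₂ xy) with ω x ℕ.≟ 1
  ... | yes ωx≡1 = ⊥-elim (weight-1⇒sink x ωx≡1 y xy)
  ... | no _ = ½⪯ (weightCoordinate y)

  embed-mono : ∀ {x y} → x ⊑ y → embed x ⪯ₙ embed y
  embed-mono x⊑y = weightCoordinate-mono x⊑y ∷ tabulate-⪯ₙ⁺ λ v → coordinate-mono v x⊑y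

  embed-reflects : ∀ {x y} → embed x ⪯ₙ embed y → x ⊑ y
  embed-reflects {x} {y} (_ ∷ p) =
    t1⪯coordinate⇒⊑ (subst (_⪯ coordinate y x) (coordinate-self x) (tabulate-⪯ₙ⁻ p x))

  embed-injective : ∀ {x y} → embed x ≡ embed y → x ≡ y
  embed-injective {x} {y} e =
    ⊑-antisym (embed-reflects (subst (embed x ⪯ₙ_) e ⪯ₙ-refl)) (embed-reflects (subst (_⪯ₙ embed x) e ⪯ₙ-refl))

  den-embed : ∀ x → den (embed x) ≡ ω x
  den-embed x with ω x ℕ.≟ 1 | weights x
  ... | yes ωx≡1 | _ = trans (den-tabulate≡1 (coordinate x) (sink⇒coordinate∈01 (weight-1⇒sink x ωx≡1))) (sym ωx≡1)
  ... | no ωx≢1 | inj₁ ωx≡1 = ⊥-elim (ωx≢1 ωx≡1)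
  ... | no _ | inj₂ ωx≡2 = sym ωx≡2

  W : SubsetOf3ⁿ (suc k)
  W y = isYes (any? λ x → ≡-dec _≟₃_ (embed x) y)

  to : Fin k → Elem W
  to x = embed x , witness⇒isYes (any? λ z → ≡-dec _≟₃_ (embed z) (embed x)) (x , refl)

  to-surjective : ∀ (w : Elem W) → ∃ λ x → ∀ {z} → z ≡ x → to z ≡ w
  to-surjective (y , y∈W) =
    let (x , embed-x≡y) = isYes⇒witness (any? λ x → ≡-dec _≟₃_ (embed x) y) y∈W
    in x , λ { refl → Elem-≡ embed-x≡y }

  ⊑⇒pair-face : ∀ {x y} → x ⊑ y → (⁅ x ⁆ ∪ ⁅ y ⁆) ∈F Δ
  ⊑⇒pair-face {x} (inj₁ refl) = subst (_∈F Δ) (sym (∪-idem ⁅ x ⁆)) (singletons x)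
  ⊑⇒pair-face (inj₂ xy) = proj₂ (only-edges _ _ xy)

  faces⇔pairwise : ∀ S → S ∈F Δ ⇔ PairwiseComparable _⊑_ S
  faces⇔pairwise S = mk⇔ face⇒pairwise pairwise⇒face
    where
    face⇒pairwise : S ∈F Δ → PairwiseComparable _⊑_ S
    face⇒pairwise S∈Δ {i} {j} i∈ j∈ with i ≟ᶠ j
    ... | yes i≡j = inj₁ (inj₁ i≡j)
    ... | no i≢j = ⊎-map inj₂ inj₂ (oriented i j (i≢j , down-closed _ S (⁅x⁆∪⁅y⁆⊆p i∈ j∈) S∈Δ))

    pairwise⇒face : PairwiseComparable _⊑_ S → S ∈F Δ
    pairwise⇒face pc = no-big-missing-face⇒flag asc no-big-missing S λ {p} {q} p∈ q∈ →
      [ ⊑⇒pair-face , subst (_∈F Δ) (∪-comm ⁅ q ⁆ ⁅ p ⁆) ∘ ⊑⇒pair-face ] (pc p∈ q∈)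

  isoToNerve : IsoToNerve Δ ω W
  isoToNerve = record
    { bij = mk⤖ {to = to} (embed-injective ∘ cong proj₁ , to-surjective)
    ; faces = λ S →
        IsChain-Image⁺ ∘ PairwiseComparable-map embed-mono ∘ Equivalence.to (faces⇔pairwise S) ,
        Equivalence.from (faces⇔pairwise S) ∘ PairwiseComparable-map embed-reflects ∘ IsChain-Image⁻
    ; weight = den-embed
    }

lemma5p6 : ∀ {k : ℕ} (Δ : Family k) (ω : Fin k → ℕ) → IsWASC Δ ω →
    (IsKleene Δ ω → ∃[ n ] (1 ≤ n × ∃[ W ] IsoToNerve Δ ω {n} W)) ×
    (∃[ n ] (1 ≤ n × ∃[ W ] IsoToNerve Δ ω {n} W) → IsKleene Δ ω)
lemma5p6 {k} Δ ω wasc =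
  (λ kleene → suc k , s≤s z≤n , ToNerve.W asc kleene , ToNerve.isoToNerve asc kleene) ,
  (λ (_ , _ , _ , iso) → FromNerve.isKleene iso)
  where
  asc : IsASC Δ
  asc = IsWASC.asc wasc
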